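{- For every positive integer $k$ and all $\alpha > 0$ and $\lambda > 0$, there exists $\tau > 0$ such that the following holds. Let $V_1,\dots,V_k$ be finite sets and let $d$ be an integer with $2 \le d \le \min\{|V_1|,\dots,|V_k|\}$. Suppose $\mathcal{H} \subseteq V_1\times\dots\times V_k$ satisfies $|\mathcal{H}| \le \tau \prod_{i=1}^k |V_i|$, and let $W_1,\dots,W_k$ be uniformly chosen random $d$-element subsets of $V_1,\dots,V_k$, respectively (chosen independently). Then \[ \Pr\left(|\mathcal{H} \cap (W_1 \times\dots\times W_k)| > \lambda d^k\right) \le \alpha^d. \]
   Formalization: The parameters α and λ range over the positive rationals, and τ is taken in the rationals. -}

module Defs where

open import Data.Bool using (Bool; true; false; _∧_)
open import Data.Nat using (ℕ; zero; suc) renaming (_*_ to _*ℕ_)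
open import Data.Fin using (Fin; zero; suc)
open import Data.Fin.Subset using (Subset; ∣_∣)
open import Data.Fin.Subset.Properties using (_∈?_)
open import Data.Rational.Properties using (_<?_)
open import Data.Vec using (Vec; []; _∷_)
open import Data.List using (List; []; _∷_; concatMap; map; length; filterᵇ; [_])
open import Data.Integer using (+_)
open import Data.Rational using (ℚ; _/_; 1ℚ) renaming (_*_ to _*ℚ_)
open import Relation.Nullary.Decidable using (⌊_⌋)
open import Data.Nat using (_≡ᵇ_; _^_)

toℚ : ℕ → ℚ
toℚ n = + n / 1

_^ℚ_ : ℚ → ℕ → ℚ
q ^ℚ zero = 1ℚ
q ^ℚ suc n = q *ℚ (q ^ℚ n)

Π : (k : ℕ) → (Fin k → Set) → Set
Π k A = (i : Fin k) → A i

consΠ : ∀ {k} {A : Fin (suc k) → Set} → A zero → Π k (λ i → A (suc i)) → Π (suc k) A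
consΠ x f zero = x
consΠ x f (suc i) = f i

allΠ : (k : ℕ) (A : Fin k → Set) → ((i : Fin k) → List (A i)) → List (Π k A)
allΠ zero A e = [ (λ ()) ]
allΠ (suc k) A e =
  concatMap (λ x → map (consΠ {A = A} x) (allΠ k (λ i → A (suc i)) (λ i → e (suc i)))) (e zero)

allFinᵇ : (k : ℕ) → (Fin k → Bool) → Bool
allFinᵇ zero p = true
allFinᵇ (suc k) p = p zero ∧ allFinᵇ k (λ i → p (suc i))

prodFin : (k : ℕ) → (Fin k → ℕ) → ℕ
prodFin zero n = 1
prodFin (suc k) n = n zero *ℕ prodFin k (λ i → n (suc i))

allFinList : (m : ℕ) → List (Fin m)
allFinList zero = []
allFinList (suc m) = zero ∷ map suc (allFinList m)

allSubsets : (m : ℕ) → List (Subset m)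
allSubsets zero = [ [] ]
allSubsets (suc m) = concatMap (λ s → (true ∷ s) ∷ (false ∷ s) ∷ []) (allSubsets m)

dSubsets : (m d : ℕ) → List (Subset m)
dSubsets m d = filterᵇ (λ s → ∣ s ∣ ≡ᵇ d) (allSubsets m)

count : {A : Set} → (A → Bool) → List A → ℕ
count p xs = length (filterᵇ p xs)

-- Points of V₁ × ⋯ × Vₖ with Vᵢ = Fin (n i).
Point : (k : ℕ) → (Fin k → ℕ) → Set
Point k n = Π k (λ i → Fin (n i))

allPoints : (k : ℕ) (n : Fin k → ℕ) → List (Point k n)
allPoints k n = allΠ k (λ i → Fin (n i)) (λ i → allFinList (n i))

Family : (k : ℕ) → (Fin k → ℕ) → Set
Family k n = Point k n → Bool

card : (k : ℕ) (n : Fin k → ℕ) → Family k n → ℕ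
card k n H = count H (allPoints k n)

Choice : (k : ℕ) → (Fin k → ℕ) → Set
Choice k n = Π k (λ i → Subset (n i))

dChoices : (k : ℕ) (n : Fin k → ℕ) (d : ℕ) → List (Choice k n)
dChoices k n d = allΠ k (λ i → Subset (n i)) (λ i → dSubsets (n i) d)

cardIn : (k : ℕ) (n : Fin k → ℕ) → Family k n → Choice k n → ℕ
cardIn k n H W = count (λ x → H x ∧ allFinᵇ k (λ i → ⌊ x i ∈? W i ⌋)) (allPoints k n)

-- Number of outcomes (W₁,…,Wₖ) of the sample space with |ℋ ∩ (W₁ × ⋯ × Wₖ)| > lam · d^k.
-- The probability is this number divided by |dChoices k n d| = ∏ (n i choose d).
badCount : (k : ℕ) (n : Fin k → ℕ) (d : ℕ) → Family k n → ℚ → ℕ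
badCount k n d H lam = count (λ W → ⌊ lam *ℚ toℚ (d ^ k) <? toℚ (cardIn k n H W) ⌋) (dChoices k n d)

module Submission where

-- Strengthen the claim to: for all Q, A ≥ 1 there is N such that, if |ℋ| · N ≤ ∏|Vᵢ|,
-- then Q · |ℋ ∩ (W₁ × ⋯ × Wₖ)| > dᵏ has probability at most A⁻ᵈ; taking Q ≥ 1/λ, A ≥ 1/α and
-- τ = 1/N gives the theorem.  Induct on k.  Call v ∈ V₁ heavy when its slice ℋᵥ ⊆ V₂ × ⋯ × Vₖ is
-- too dense for the induction hypothesis; by averaging, heavy vertices form a sparse set S ⊆ V₁.
-- If the intersection is large, then either W₁ meets S in more than d/2Q points, which has
-- probability at most (2A)⁻ᵈ by a hypergeometric tail bound (P(|W₁ ∩ S| ≥ m) ≤ 2ᵈ (|S|/|V₁|)ᵐ),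
-- or some light v ∈ W₁ has 2Q · |ℋᵥ ∩ (W₂ × ⋯ × Wₖ)| > dᵏ⁻¹, which by the induction hypothesis
-- (with 2Q and 4A) has probability at most d · (4A)⁻ᵈ.  Both are at most A⁻ᵈ / 2.

open import Defs

module Concentration where

  open import Data.Bool using (Bool; true; false; _∧_; T; T?; not)
  open import Data.Nat
  open import Data.Nat.Properties
  open import Data.Nat.Combinatorics using (_C_; nCk+nC[k+1]≡[n+1]C[k+1]; k>n⇒nCk≡0; nC1≡n)
  open import Data.Nat.DivMod using (_/_; _%_; m%n<n; m≡m%n+[m/n]*n; m/n*n≤m)
  open import Data.Nat.Tactic.RingSolver using (solve-∀)
  open import Data.List using (List; []; _∷_; _++_; map; concatMap; filterᵇ; length)
  open import Data.List.Relation.Unary.All as All using (All; []; _∷_)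
  open import Data.List.Relation.Unary.All.Properties using (all-filter; concat⁺; map⁺)
  open import Data.Bool.Properties using (∧-zeroʳ; T-∧)
  open import Data.Product using (∃-syntax; _×_; _,_; proj₁; proj₂)
  open import Relation.Binary.PropositionalEquality using (_≡_; refl; sym; trans; cong; cong₂; subst; subst₂; module ≡-Reasoning)
  open import Relation.Nullary using (contradiction)
  open import Function using (_∘_; Equivalence)
  open import Data.Fin using (Fin; zero; suc)
  open import Data.Fin.Subset using (Subset; ∣_∣; _∩_)
  open import Data.Fin.Subset.Properties using (_∈?_; ∣p∩q∣≤∣p∣; ∣p∣≤n)
  open import Relation.Nullary.Decidable using (Dec; ⌊_⌋; yes; no)
  open import Data.Vec using (_∷_; []; tabulate)
  open import Algebra.Properties.CommutativeSemigroup +-commutativeSemigroup using (interchange)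

  -- Finite sums and counting

  private
    variable
      A B : Set

  𝟙 : Bool → ℕ
  𝟙 true = 1
  𝟙 false = 0

  ∑ : List A → (A → ℕ) → ℕ
  ∑ [] f = 0
  ∑ (x ∷ xs) f = f x + ∑ xs f

  infix 5 ∑
  syntax ∑ xs (λ x → e) = ∑[ x ∈ xs ] e

  module _ {f g : A → ℕ} where

    ∑-cong : ∀ xs → (∀ x → f x ≡ g x) → ∑ xs f ≡ ∑ xs g
    ∑-cong [] _ = refl
    ∑-cong (x ∷ xs) f≡g = cong₂ _+_ (f≡g x) (∑-cong xs f≡g)

    ∑-mono : ∀ {xs} → All (λ x → f x ≤ g x) xs → ∑ xs f ≤ ∑ xs g
    ∑-mono [] = z≤n
    ∑-mono (fx≤gx ∷ f≤g) = +-mono-≤ fx≤gx (∑-mono f≤g)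

    ∑-+ : ∀ xs → ∑[ x ∈ xs ] (f x + g x) ≡ ∑ xs f + ∑ xs g
    ∑-+ [] = refl
    ∑-+ (x ∷ xs) = trans (cong (f x + g x +_) (∑-+ xs)) (interchange (f x) (g x) _ _)

  ∑-mono-∀ : ∀ {f g : A → ℕ} xs → (∀ x → f x ≤ g x) → ∑ xs f ≤ ∑ xs g
  ∑-mono-∀ xs f≤g = ∑-mono (All.universal f≤g xs)

  ∑-*ˡ : ∀ c (f : A → ℕ) xs → ∑[ x ∈ xs ] (c * f x) ≡ c * ∑ xs f
  ∑-*ˡ c f [] = sym (*-zeroʳ c)
  ∑-*ˡ c f (x ∷ xs) = trans (cong (c * f x +_) (∑-*ˡ c f xs)) (sym (*-distribˡ-+ c (f x) _))

  ∑-*ʳ : ∀ (f : A → ℕ) c xs → ∑[ x ∈ xs ] (f x * c) ≡ ∑ xs f * c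
  ∑-*ʳ f c xs = trans (∑-cong xs (λ x → *-comm (f x) c)) (trans (∑-*ˡ c f xs) (*-comm c _))

  ∑-const : ∀ c (xs : List A) → ∑[ _ ∈ xs ] c ≡ length xs * c
  ∑-const c [] = refl
  ∑-const c (x ∷ xs) = cong (c +_) (∑-const c xs)

  ∑-++ : ∀ (f : A → ℕ) xs ys → ∑ (xs ++ ys) f ≡ ∑ xs f + ∑ ys f
  ∑-++ f [] ys = refl
  ∑-++ f (x ∷ xs) ys = trans (cong (f x +_) (∑-++ f xs ys)) (sym (+-assoc (f x) _ _))

  ∑-concatMap : ∀ (f : B → ℕ) (g : A → List B) xs → ∑ (concatMap g xs) f ≡ ∑[ x ∈ xs ] ∑ (g x) f
  ∑-concatMap f g [] = refl
  ∑-concatMap f g (x ∷ xs) = trans (∑-++ f (g x) (concatMap g xs)) (cong (∑ (g x) f +_) (∑-concatMap f g xs))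

  ∑-map : ∀ (f : B → ℕ) (g : A → B) xs → ∑ (map g xs) f ≡ ∑[ x ∈ xs ] f (g x)
  ∑-map f g [] = refl
  ∑-map f g (x ∷ xs) = cong (f (g x) +_) (∑-map f g xs)

  ∑-comm : ∀ (f : A → B → ℕ) xs ys → ∑[ x ∈ xs ] ∑[ y ∈ ys ] f x y ≡ ∑[ y ∈ ys ] ∑[ x ∈ xs ] f x y
  ∑-comm f [] ys = sym (trans (∑-const 0 ys) (*-zeroʳ (length ys)))
  ∑-comm f (x ∷ xs) ys = trans (cong (∑ ys (f x) +_) (∑-comm f xs ys)) (sym (∑-+ ys))

  count≡∑ : ∀ (p : A → Bool) xs → count p xs ≡ ∑[ x ∈ xs ] 𝟙 (p x)
  count≡∑ p [] = refl
  count≡∑ p (x ∷ xs) with p x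
  ... | true = cong suc (count≡∑ p xs)
  ... | false = count≡∑ p xs

  count-∷ : ∀ (p : A → Bool) x xs → count p (x ∷ xs) ≡ 𝟙 (p x) + count p xs
  count-∷ p x xs with p x
  ... | true = refl
  ... | false = refl

  count-mono : ∀ {p q : A → Bool} {xs} → All (λ x → T (p x) → T (q x)) xs → count p xs ≤ count q xs
  count-mono {p = p} {q} {xs} p⇒q = begin
    count p xs           ≡⟨ count≡∑ p xs ⟩
    ∑[ x ∈ xs ] 𝟙 (p x)  ≤⟨ ∑-mono (All.map 𝟙-mono p⇒q) ⟩
    ∑[ x ∈ xs ] 𝟙 (q x)  ≡⟨ count≡∑ q xs ⟨
    count q xs           ∎
    where
    open ≤-Reasoning
    𝟙-mono : ∀ {b c} → (T b → T c) → 𝟙 b ≤ 𝟙 c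
    𝟙-mono {false} _ = z≤n
    𝟙-mono {true} {true} _ = ≤-refl
    𝟙-mono {true} {false} b⇒c = contradiction (b⇒c _) λ ()

  count-cong : ∀ {p q : A → Bool} xs → (∀ x → p x ≡ q x) → count p xs ≡ count q xs
  count-cong {p = p} {q} xs p≡q =
    trans (count≡∑ p xs) (trans (∑-cong xs (cong 𝟙 ∘ p≡q)) (sym (count≡∑ q xs)))

  count-true : ∀ (xs : List A) → count (λ _ → true) xs ≡ length xs
  count-true [] = refl
  count-true (x ∷ xs) = cong suc (count-true xs)

  count≤length : ∀ (p : A → Bool) xs → count p xs ≤ length xs
  count≤length p xs = ≤-trans (count-mono (All.universal (λ _ _ → _) xs)) (≤-reflexive (count-true xs))

  count-false : ∀ (xs : List A) → count (λ _ → false) xs ≡ 0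
  count-false [] = refl
  count-false (x ∷ xs) = count-false xs

  count-map : ∀ (p : B → Bool) (f : A → B) xs → count p (map f xs) ≡ count (λ x → p (f x)) xs
  count-map p f xs = trans (count≡∑ p (map f xs)) (trans (∑-map (𝟙 ∘ p) f xs) (sym (count≡∑ (p ∘ f) xs)))

  count-concatMap : ∀ (p : B → Bool) (g : A → List B) xs → count p (concatMap g xs) ≡ ∑[ x ∈ xs ] count p (g x)
  count-concatMap p g xs = trans (count≡∑ p (concatMap g xs))
    (trans (∑-concatMap (𝟙 ∘ p) g xs) (∑-cong xs (λ x → sym (count≡∑ p (g x)))))

  count-filterᵇ : ∀ (g p : A → Bool) xs → count p (filterᵇ g xs) ≡ count (λ x → g x ∧ p x) xs
  count-filterᵇ g p [] = refl
  count-filterᵇ g p (x ∷ xs) with g x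
  ... | false = count-filterᵇ g p xs
  ... | true with p x
  ...   | true = cong suc (count-filterᵇ g p xs)
  ...   | false = count-filterᵇ g p xs

  count-∧-guard : ∀ (p q : A → Bool) b xs → count (λ x → p x ∧ (b ∧ q x)) xs ≡ 𝟙 b * count (λ x → p x ∧ q x) xs
  count-∧-guard p q true xs = sym (+-identityʳ _)
  count-∧-guard p q false xs = trans (count-cong xs (λ x → ∧-zeroʳ (p x))) (count-false xs)

  𝟙-split : ∀ b c r → (T b → r ≡ 0 → T c) → 𝟙 b ≤ 𝟙 c + r
  𝟙-split false c r _ = z≤n
  𝟙-split true c (suc r) _ = ≤-trans (s≤s z≤n) (m≤n+m (suc r) (𝟙 c))
  𝟙-split true true zero _ = ≤-refl
  𝟙-split true false zero b⇒c = contradiction (b⇒c _ refl) λ ()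

  -- Powers and binomial coefficients

  *-distribʳ-^ : ∀ m n o → (m * n) ^ o ≡ m ^ o * n ^ o
  *-distribʳ-^ m n zero = refl
  *-distribʳ-^ m n (suc o) = trans (cong (m * n *_) (*-distribʳ-^ m n o)) (reorder m n (m ^ o) (n ^ o))
    where
    reorder : ∀ a b x y → a * b * (x * y) ≡ a * x * (b * y)
    reorder = solve-∀

  2≤2^ : ∀ d → 1 ≤ d → 2 ≤ 2 ^ d
  2≤2^ (suc d) _ = *-monoʳ-≤ 2 (m^n>0 2 d)

  2*n≤4^n : ∀ n → 2 * n ≤ 4 ^ n
  2*n≤4^n zero = z≤n
  2*n≤4^n (suc n) = begin
    2 * suc n          ≡⟨ *-suc 2 n ⟩
    2 + 2 * n          ≤⟨ +-mono-≤ (*-monoʳ-≤ 2 (m^n>0 4 n)) (2*n≤4^n n) ⟩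
    2 * 4 ^ n + 4 ^ n  ≤⟨ +-monoˡ-≤ (4 ^ n) (*-monoˡ-≤ (4 ^ n) {2} {3} (s≤s (s≤s z≤n))) ⟩
    3 * 4 ^ n + 4 ^ n  ≡⟨ merge (4 ^ n) ⟩
    4 * 4 ^ n          ∎
    where
    open ≤-Reasoning
    merge : ∀ x → 3 * x + x ≡ 4 * x
    merge = solve-∀

  pascal : ∀ n k → suc n C suc k ≡ n C k + n C suc k
  pascal n k = sym (nCk+nC[k+1]≡[n+1]C[k+1] n k)

  C≤2^ : ∀ n k → n C k ≤ 2 ^ n
  C≤2^ n zero = m^n>0 2 n
  C≤2^ zero (suc k) = z≤n
  C≤2^ (suc n) (suc k) rewrite pascal n k =
    ≤-trans (+-mono-≤ (C≤2^ n k) (C≤2^ n (suc k))) (≤-reflexive (cong (2 ^ n +_) (sym (+-identityʳ _))))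

  C-monoˡ-≤ : ∀ {m n} k → m ≤ n → m C k ≤ n C k
  C-monoˡ-≤ zero _ = ≤-refl
  C-monoˡ-≤ {zero} (suc k) _ = z≤n
  C-monoˡ-≤ {suc m} {suc n} (suc k) (s≤s m≤n) rewrite pascal m k | pascal n k =
    +-mono-≤ (C-monoˡ-≤ k m≤n) (C-monoˡ-≤ (suc k) m≤n)

  C-absorption : ∀ n k → suc k * (suc n C suc k) ≡ suc n * (n C k)
  C-absorption zero zero = refl
  C-absorption zero (suc k) = *-zeroʳ (suc (suc k))
  C-absorption (suc n) zero = trans (*-identityˡ _) (trans (nC1≡n (suc (suc n))) (sym (*-identityʳ (suc (suc n)))))
  C-absorption (suc n) (suc k) = begin
    suc (suc k) * (suc (suc n) C suc (suc k))
      ≡⟨ cong (suc (suc k) *_) (pascal (suc n) (suc k)) ⟩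
    suc (suc k) * (suc n C suc k + suc n C suc (suc k))
      ≡⟨ split (suc k) (suc n C suc k) (suc n C suc (suc k)) ⟩
    suc k * (suc n C suc k) + suc n C suc k + suc (suc k) * (suc n C suc (suc k))
      ≡⟨ cong₂ (λ a b → a + suc n C suc k + b) (C-absorption n k) (C-absorption n (suc k)) ⟩
    suc n * (n C k) + suc n C suc k + suc n * (n C suc k)
      ≡⟨ cong (λ c → suc n * (n C k) + c + suc n * (n C suc k)) (pascal n k) ⟩
    suc n * (n C k) + (n C k + n C suc k) + suc n * (n C suc k)
      ≡⟨ merge (suc n) (n C k) (n C suc k) ⟩
    suc (suc n) * (n C k + n C suc k)
      ≡⟨ cong (suc (suc n) *_) (pascal n k) ⟨
    suc (suc n) * (suc n C suc k)
      ∎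
    where
    open ≡-Reasoning
    split : ∀ a b c → suc a * (b + c) ≡ a * b + b + suc a * c
    split = solve-∀
    merge : ∀ a b c → a * b + (b + c) + a * c ≡ suc a * (b + c)
    merge = solve-∀

  C-split : ∀ n m e → (n C m) * ((n ∸ m) C e) ≡ (n C (m + e)) * ((m + e) C m)
  C-split n zero e = trans (*-identityˡ (n C e)) (sym (*-identityʳ (n C e)))
  C-split zero (suc m) e = refl
  C-split (suc n) (suc m) e = *-cancelˡ-≡ _ _ (a * b) (begin
    a * b * ((suc n C a) * X)          ≡⟨ swap₁ a b (suc n C a) X ⟩
    b * (a * (suc n C a)) * X          ≡⟨ cong (λ t → b * t * X) (C-absorption n m) ⟩
    b * (suc n * (n C m)) * X          ≡⟨ swap₂ b (suc n) (n C m) X ⟩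
    suc n * b * ((n C m) * X)          ≡⟨ cong (suc n * b *_) (C-split n m e) ⟩
    suc n * b * ((n C (m + e)) * Y)    ≡⟨ swap₃ (suc n) b (n C (m + e)) Y ⟩
    suc n * (n C (m + e)) * (b * Y)    ≡⟨ cong₂ _*_ (C-absorption n (m + e)) (C-absorption (m + e) m) ⟨
    b * (suc n C b) * (a * (b C a))    ≡⟨ swap₄ a b (suc n C b) (b C a) ⟩
    a * b * ((suc n C b) * (b C a))    ∎)
    where
    open ≡-Reasoning
    a b X Y : ℕ
    a = suc m
    b = suc (m + e)
    X = (n ∸ m) C e
    Y = (m + e) C m
    swap₁ : ∀ a b c x → a * b * (c * x) ≡ b * (a * c) * x
    swap₁ = solve-∀
    swap₂ : ∀ b n c x → b * (n * c) * x ≡ n * b * (c * x)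
    swap₂ = solve-∀
    swap₃ : ∀ n b c y → n * b * (c * y) ≡ (n * c) * (b * y)
    swap₃ = solve-∀
    swap₄ : ∀ a b c d → (b * c) * (a * d) ≡ a * b * (c * d)
    swap₄ = solve-∀

  C-shift : ∀ {s n} m e → s ≤ n → (s C suc m) * (suc (n ∸ suc m) C e) ≤ (s C suc m) * ((n ∸ m) C e)
  C-shift {s} {n} m e s≤n with m <? n
  ... | yes m<n = ≤-reflexive (cong (λ t → (s C suc m) * (t C e)) (sym (+-∸-assoc 1 m<n)))
  ... | no m≮n rewrite k>n⇒nCk≡0 (s≤s (≤-trans s≤n (≮⇒≥ m≮n))) = z≤n

  ^-ratio-suc : ∀ {s n} m X Y → .{{NonZero s}} → s ≤ n →
                X * n ^ m ≤ Y * s ^ m → X * suc n ^ m ≤ Y * suc s ^ m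
  ^-ratio-suc {s} {n} m X Y s≤n le = *-cancelʳ-≤ _ _ (s ^ m) {{m^n≢0 s m}} (begin
    X * suc n ^ m * s ^ m        ≡⟨ trans (*-assoc X _ _) (cong (X *_) (sym (*-distribʳ-^ (suc n) s m))) ⟩
    X * (suc n * s) ^ m          ≤⟨ *-monoʳ-≤ X (^-monoˡ-≤ m ratio) ⟩
    X * (n * suc s) ^ m          ≡⟨ trans (cong (X *_) (*-distribʳ-^ n (suc s) m)) (sym (*-assoc X _ _)) ⟩
    X * n ^ m * suc s ^ m        ≤⟨ *-monoˡ-≤ (suc s ^ m) le ⟩
    Y * s ^ m * suc s ^ m        ≡⟨ *-comm-middle Y (s ^ m) (suc s ^ m) ⟩
    Y * suc s ^ m * s ^ m        ∎)
    where
    open ≤-Reasoning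
    ratio : suc n * s ≤ n * suc s
    ratio = ≤-trans (+-monoˡ-≤ (n * s) s≤n) (≤-reflexive (sym (*-suc n s)))
    *-comm-middle : ∀ a b c → a * b * c ≡ a * c * b
    *-comm-middle = solve-∀

  C-ratio : ∀ m {s n} → s ≤ n → (s C m) * n ^ m ≤ (n C m) * s ^ m
  C-ratio-suc : ∀ m {s n} → s ≤ n → (s C m) * suc n ^ m ≤ (n C m) * suc s ^ m

  C-ratio zero _ = ≤-refl
  C-ratio (suc m) {zero} _ = z≤n
  C-ratio (suc m) {suc s} {suc n} (s≤s s≤n) = *-cancelˡ-≤ (suc m) (begin
    suc m * ((suc s C suc m) * suc n ^ suc m)       ≡⟨ *-assoc (suc m) (suc s C suc m) _ ⟨
    suc m * (suc s C suc m) * suc n ^ suc m         ≡⟨ cong (_* suc n ^ suc m) (C-absorption s m) ⟩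
    suc s * (s C m) * (suc n * suc n ^ m)           ≡⟨ regroup (suc s) (s C m) (suc n) (suc n ^ m) ⟩
    suc s * suc n * ((s C m) * suc n ^ m)           ≤⟨ *-monoʳ-≤ (suc s * suc n) (C-ratio-suc m s≤n) ⟩
    suc s * suc n * ((n C m) * suc s ^ m)           ≡⟨ regroup′ (suc n) (n C m) (suc s) (suc s ^ m) ⟨
    suc n * (n C m) * (suc s * suc s ^ m)           ≡⟨ cong (_* suc s ^ suc m) (C-absorption n m) ⟨
    suc m * (suc n C suc m) * suc s ^ suc m         ≡⟨ *-assoc (suc m) (suc n C suc m) _ ⟩
    suc m * ((suc n C suc m) * suc s ^ suc m)       ∎)
    where
    open ≤-Reasoning
    regroup : ∀ a b c x → a * b * (c * x) ≡ a * c * (b * x)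
    regroup = solve-∀
    regroup′ : ∀ a b c x → a * b * (c * x) ≡ c * a * (b * x)
    regroup′ = solve-∀

  C-ratio-suc zero _ = ≤-refl
  C-ratio-suc (suc m) {zero} _ = z≤n
  C-ratio-suc m {suc s} {n} s≤n = ^-ratio-suc m (suc s C m) (n C m) s≤n (C-ratio m s≤n)

  -- Random d-subsets and the hypergeometric tail

  ∣∷∣ : ∀ {n} b (W : Subset n) → ∣ b ∷ W ∣ ≡ 𝟙 b + ∣ W ∣
  ∣∷∣ true W = refl
  ∣∷∣ false W = refl

  ∈?-zero : ∀ {n} b (W : Subset n) → ⌊ zero ∈? (b ∷ W) ⌋ ≡ b
  ∈?-zero true W = refl
  ∈?-zero false W = refl

  ∈?-suc : ∀ {n} b (W : Subset n) v → ⌊ suc v ∈? (b ∷ W) ⌋ ≡ ⌊ v ∈? W ⌋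
  ∈?-suc b W v with v ∈? W
  ... | yes _ = refl
  ... | no _ = refl

  count-∈ : ∀ {n} (W : Subset n) → count (λ v → ⌊ v ∈? W ⌋) (allFinList n) ≡ ∣ W ∣
  count-∈ [] = refl
  count-∈ {suc n} (b ∷ W) = begin
    count (λ v → ⌊ v ∈? (b ∷ W) ⌋) (zero ∷ map suc (allFinList n))
      ≡⟨ count-∷ (λ v → ⌊ v ∈? (b ∷ W) ⌋) zero _ ⟩
    𝟙 ⌊ zero ∈? (b ∷ W) ⌋ + count (λ v → ⌊ v ∈? (b ∷ W) ⌋) (map suc (allFinList n))
      ≡⟨ cong₂ _+_ (cong 𝟙 (∈?-zero b W)) (count-map _ suc (allFinList n)) ⟩
    𝟙 b + count (λ v → ⌊ suc v ∈? (b ∷ W) ⌋) (allFinList n)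
      ≡⟨ cong (𝟙 b +_) (trans (count-cong (allFinList n) (∈?-suc b W)) (count-∈ W)) ⟩
    𝟙 b + ∣ W ∣
      ≡⟨ ∣∷∣ b W ⟨
    ∣ b ∷ W ∣
      ∎
    where open ≡-Reasoning

  count-tabulate : ∀ {n} (f : Fin n → Bool) → count f (allFinList n) ≡ ∣ tabulate f ∣
  count-tabulate {zero} f = refl
  count-tabulate {suc n} f = trans (count-∷ f zero _)
    (trans (cong (𝟙 (f zero) +_) (trans (count-map f suc (allFinList n)) (count-tabulate (f ∘ suc))))
           (sym (∣∷∣ (f zero) (tabulate (f ∘ suc)))))

  count-∈-∩ : ∀ {n} (W : Subset n) (f : Fin n → Bool) →
    count (λ v → ⌊ v ∈? W ⌋ ∧ f v) (allFinList n) ≡ ∣ W ∩ tabulate f ∣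
  count-∈-∩ [] f = refl
  count-∈-∩ {suc n} (b ∷ W) f = begin
    count (λ v → ⌊ v ∈? (b ∷ W) ⌋ ∧ f v) (zero ∷ map suc (allFinList n))
      ≡⟨ count-∷ (λ v → ⌊ v ∈? (b ∷ W) ⌋ ∧ f v) zero _ ⟩
    𝟙 (⌊ zero ∈? (b ∷ W) ⌋ ∧ f zero) + count (λ v → ⌊ v ∈? (b ∷ W) ⌋ ∧ f v) (map suc (allFinList n))
      ≡⟨ cong₂ _+_ (cong (λ c → 𝟙 (c ∧ f zero)) (∈?-zero b W)) (count-map _ suc (allFinList n)) ⟩
    𝟙 (b ∧ f zero) + count (λ v → ⌊ suc v ∈? (b ∷ W) ⌋ ∧ f (suc v)) (allFinList n)
      ≡⟨ cong (𝟙 (b ∧ f zero) +_) (trans (count-cong (allFinList n) (λ v → cong (_∧ f (suc v)) (∈?-suc b W v)))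
                                          (count-∈-∩ W (f ∘ suc))) ⟩
    𝟙 (b ∧ f zero) + ∣ W ∩ tabulate (f ∘ suc) ∣
      ≡⟨ ∣∷∣ (b ∧ f zero) (W ∩ tabulate (f ∘ suc)) ⟨
    ∣ (b ∷ W) ∩ tabulate f ∣
      ∎
    where open ≡-Reasoning

  count-dSubsets : ∀ n D (p : Subset (suc n) → Bool) → count p (dSubsets (suc n) D) ≡
    count (λ W → (∣ true ∷ W ∣ ≡ᵇ D) ∧ p (true ∷ W)) (allSubsets n) +
    count (λ W → (∣ W ∣ ≡ᵇ D) ∧ p (false ∷ W)) (allSubsets n)
  count-dSubsets n D p = begin
    count p (dSubsets (suc n) D)
      ≡⟨ trans (count-filterᵇ sized p (allSubsets (suc n))) (count≡∑ _ (allSubsets (suc n))) ⟩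
    ∑[ W ∈ allSubsets (suc n) ] 𝟙 (sized W ∧ p W)
      ≡⟨ ∑-concatMap _ (λ W → (true ∷ W) ∷ (false ∷ W) ∷ []) (allSubsets n) ⟩
    ∑[ W ∈ allSubsets n ] (𝟙 (sized (true ∷ W) ∧ p (true ∷ W)) + (𝟙 (sized (false ∷ W) ∧ p (false ∷ W)) + 0))
      ≡⟨ ∑-cong (allSubsets n) (λ W → cong (𝟙 (sized (true ∷ W) ∧ p (true ∷ W)) +_) (+-identityʳ _)) ⟩
    ∑[ W ∈ allSubsets n ] (𝟙 (sized (true ∷ W) ∧ p (true ∷ W)) + 𝟙 (sized (false ∷ W) ∧ p (false ∷ W)))
      ≡⟨ ∑-+ (allSubsets n) ⟩
    _
      ≡⟨ cong₂ _+_ (count≡∑ _ (allSubsets n)) (count≡∑ _ (allSubsets n)) ⟨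
    _ ∎
    where
    open ≡-Reasoning
    sized : Subset (suc n) → Bool
    sized W = ∣ W ∣ ≡ᵇ D

  count-dSubsets-zero : ∀ n (p : Subset (suc n) → Bool) →
    count p (dSubsets (suc n) 0) ≡ count (λ W → p (false ∷ W)) (dSubsets n 0)
  count-dSubsets-zero n p = begin
    count p (dSubsets (suc n) 0)
      ≡⟨ count-dSubsets n 0 p ⟩
    count (λ _ → false) (allSubsets n) + count empty (allSubsets n)
      ≡⟨ cong (_+ count empty (allSubsets n)) (count-false (allSubsets n)) ⟩
    count empty (allSubsets n)
      ≡⟨ count-filterᵇ (λ W → ∣ W ∣ ≡ᵇ 0) (λ W → p (false ∷ W)) (allSubsets n) ⟨
    count (λ W → p (false ∷ W)) (dSubsets n 0)
      ∎
    where
    open ≡-Reasoning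
    empty : Subset n → Bool
    empty W = (∣ W ∣ ≡ᵇ 0) ∧ p (false ∷ W)

  count-dSubsets-suc : ∀ n d (p : Subset (suc n) → Bool) → count p (dSubsets (suc n) (suc d)) ≡
    count (λ W → p (true ∷ W)) (dSubsets n d) + count (λ W → p (false ∷ W)) (dSubsets n (suc d))
  count-dSubsets-suc n d p = trans (count-dSubsets n (suc d) p)
    (sym (cong₂ _+_ (count-filterᵇ (λ W → ∣ W ∣ ≡ᵇ d) (λ W → p (true ∷ W)) (allSubsets n))
                    (count-filterᵇ (λ W → ∣ W ∣ ≡ᵇ suc d) (λ W → p (false ∷ W)) (allSubsets n))))

  length-dSubsets : ∀ n d → length (dSubsets n d) ≡ n C d
  length-dSubsets n d = trans (sym (count-true (dSubsets n d))) (counted n d)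
    where
    counted : ∀ n d → count (λ _ → true) (dSubsets n d) ≡ n C d
    counted zero zero = refl
    counted zero (suc d) = refl
    counted (suc n) zero = trans (count-dSubsets-zero n (λ _ → true)) (counted n zero)
    counted (suc n) (suc d) = trans (count-dSubsets-suc n d (λ _ → true)) (trans (cong₂ _+_ (counted n d) (counted n (suc d))) (sym (pascal n d)))

  dSubsets-size : ∀ n d → All (λ W → ∣ W ∣ ≡ d) (dSubsets n d)
  dSubsets-size n d = All.map (≡ᵇ⇒≡ _ d) (all-filter (T? ∘ λ W → ∣ W ∣ ≡ᵇ d) (allSubsets n))

  ≤ᵇ-suc : ∀ m n → (suc m ≤ᵇ suc n) ≡ (m ≤ᵇ n)
  ≤ᵇ-suc zero n = refl
  ≤ᵇ-suc (suc m) n = refl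

  meeting : ∀ {n} → Subset n → ℕ → ℕ → ℕ
  meeting {n} S m d = count (λ W → m ≤ᵇ ∣ W ∩ S ∣) (dSubsets n d)

  meeting-vanishes : ∀ {n d m} (S : Subset n) → d < m → meeting S m d ≡ 0
  meeting-vanishes {n} {d} {m} S d<m = n≤0⇒n≡0 (begin
    meeting S m d                       ≤⟨ count-mono (All.map (λ {W} → impossible W) (dSubsets-size n d)) ⟩
    count (λ _ → false) (dSubsets n d)  ≡⟨ count-false (dSubsets n d) ⟩
    0                                   ∎)
    where
    open ≤-Reasoning
    impossible : ∀ W → ∣ W ∣ ≡ d → T (m ≤ᵇ ∣ W ∩ S ∣) → T false
    impossible W ∣W∣≡d m≤ = <⇒≱ d<m (≤-trans (≤ᵇ⇒≤ m _ m≤) (subst (∣ W ∩ S ∣ ≤_) ∣W∣≡d (∣p∩q∣≤∣p∣ W S)))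

  meeting-inside : ∀ {n} (S : Subset n) m d → meeting (true ∷ S) (suc m) (suc d) ≡ meeting S m d + meeting S (suc m) (suc d)
  meeting-inside {n} S m d = trans (count-dSubsets-suc n d _)
    (cong (_+ meeting S (suc m) (suc d)) (count-cong (dSubsets n d) (λ W → ≤ᵇ-suc m ∣ W ∩ S ∣)))

  meeting-outside : ∀ {n} (S : Subset n) m d → meeting (false ∷ S) m (suc d) ≡ meeting S m d + meeting S m (suc d)
  meeting-outside {n} S m d = count-dSubsets-suc n d _

  -- Choose m points of W inside S, then the remaining e points outside those m.
  meeting≤ : ∀ {n} (S : Subset n) m e → meeting S m (m + e) ≤ (∣ S ∣ C m) * ((n ∸ m) C e)
  meeting≤ {n} S zero e = ≤-reflexive (trans (count-true (dSubsets n e)) (trans (length-dSubsets n e) (sym (*-identityˡ _))))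
  meeting≤ {zero} [] (suc m) e = z≤n
  meeting≤ {suc n} (true ∷ S) (suc m) e = begin
    meeting (true ∷ S) (suc m) (suc m + e)
      ≡⟨ meeting-inside S m (m + e) ⟩
    meeting S m (m + e) + meeting S (suc m) (suc m + e)
      ≤⟨ +-mono-≤ (meeting≤ S m e) (meeting≤ S (suc m) e) ⟩
    (s C m) * ((n ∸ m) C e) + (s C suc m) * ((n ∸ suc m) C e)
      ≤⟨ +-monoʳ-≤ ((s C m) * ((n ∸ m) C e)) (*-monoʳ-≤ (s C suc m) (C-monoˡ-≤ e (∸-monoʳ-≤ n (n≤1+n m)))) ⟩
    (s C m) * ((n ∸ m) C e) + (s C suc m) * ((n ∸ m) C e)
      ≡⟨ trans (cong (_* ((n ∸ m) C e)) (pascal s m)) (*-distribʳ-+ ((n ∸ m) C e) (s C m) (s C suc m)) ⟨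
    (suc s C suc m) * ((n ∸ m) C e)
      ∎
    where
    open ≤-Reasoning
    s : ℕ
    s = ∣ S ∣
  meeting≤ {suc n} (false ∷ S) (suc m) zero = begin
    meeting (false ∷ S) (suc m) (suc m + 0)
      ≡⟨ meeting-outside S (suc m) (m + 0) ⟩
    meeting S (suc m) (m + 0) + meeting S (suc m) (suc m + 0)
      ≡⟨ cong (_+ meeting S (suc m) (suc m + 0)) (meeting-vanishes S (s≤s (≤-reflexive (+-identityʳ m)))) ⟩
    meeting S (suc m) (suc m + 0)
      ≤⟨ meeting≤ S (suc m) zero ⟩
    (∣ S ∣ C suc m) * 1
      ∎
    where open ≤-Reasoning
  meeting≤ {suc n} (false ∷ S) (suc m) (suc e) = begin
    meeting (false ∷ S) (suc m) (suc m + suc e)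
      ≡⟨ meeting-outside S (suc m) (m + suc e) ⟩
    meeting S (suc m) (m + suc e) + meeting S (suc m) (suc m + suc e)
      ≡⟨ cong (λ d → meeting S (suc m) d + meeting S (suc m) (suc m + suc e)) (+-suc m e) ⟩
    meeting S (suc m) (suc m + e) + meeting S (suc m) (suc m + suc e)
      ≤⟨ +-mono-≤ (meeting≤ S (suc m) e) (meeting≤ S (suc m) (suc e)) ⟩
    (s C suc m) * ((n ∸ suc m) C e) + (s C suc m) * ((n ∸ suc m) C suc e)
      ≡⟨ trans (cong ((s C suc m) *_) (pascal (n ∸ suc m) e)) (*-distribˡ-+ (s C suc m) _ _) ⟨
    (s C suc m) * (suc (n ∸ suc m) C suc e)
      ≤⟨ C-shift m (suc e) (∣p∣≤n S) ⟩
    (s C suc m) * ((n ∸ m) C suc e)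
      ∎
    where
    open ≤-Reasoning
    s : ℕ
    s = ∣ S ∣

  meeting-ratio : ∀ {n m d} (S : Subset n) → m ≤ d → meeting S m d * n ^ m ≤ (n C d) * 2 ^ d * ∣ S ∣ ^ m
  meeting-ratio {n} {m} {d} S m≤d =
    subst (λ d → meeting S m d * n ^ m ≤ (n C d) * 2 ^ d * s ^ m) (m+[n∸m]≡n m≤d) (bound (d ∸ m))
    where
    open ≤-Reasoning
    s : ℕ
    s = ∣ S ∣
    swap-last : ∀ a b c → a * b * c ≡ a * c * b
    swap-last = solve-∀
    bound : ∀ e → meeting S m (m + e) * n ^ m ≤ (n C (m + e)) * 2 ^ (m + e) * s ^ m
    bound e = begin
      meeting S m (m + e) * n ^ m                ≤⟨ *-monoˡ-≤ (n ^ m) (meeting≤ S m e) ⟩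
      (s C m) * ((n ∸ m) C e) * n ^ m            ≡⟨ swap-last (s C m) ((n ∸ m) C e) (n ^ m) ⟩
      (s C m) * n ^ m * ((n ∸ m) C e)            ≤⟨ *-monoˡ-≤ ((n ∸ m) C e) (C-ratio m (∣p∣≤n S)) ⟩
      (n C m) * s ^ m * ((n ∸ m) C e)            ≡⟨ swap-last (n C m) (s ^ m) ((n ∸ m) C e) ⟩
      (n C m) * ((n ∸ m) C e) * s ^ m            ≡⟨ cong (_* s ^ m) (C-split n m e) ⟩
      (n C (m + e)) * ((m + e) C m) * s ^ m      ≤⟨ *-monoˡ-≤ (s ^ m) (*-monoʳ-≤ (n C (m + e)) (C≤2^ (m + e) m)) ⟩
      (n C (m + e)) * 2 ^ (m + e) * s ^ m        ∎

  -- With m = ⌊d/Q⌋ + 1, Q · |W ∩ S| > d forces |W ∩ S| ≥ m, and the sparseness of S pays for the factor 2ᵈ.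
  few-heavy-meetings : ∀ Q A .{{_ : NonZero Q}} .{{_ : NonZero A}} {n d} (S : Subset n) → 1 ≤ d → d ≤ n →
    ∣ S ∣ * (2 * A) ^ Q ≤ n → count (λ W → d <ᵇ Q * ∣ W ∩ S ∣) (dSubsets n d) * A ^ d ≤ n C d
  few-heavy-meetings Q A {n} {d} S 1≤d d≤n sparse =
    *-cancelʳ-≤ _ _ (n ^ m) {{m^n≢0 n m {{>-nonZero (≤-trans 1≤d d≤n)}}}} (begin
      count (λ W → d <ᵇ Q * ∣ W ∩ S ∣) (dSubsets n d) * A ^ d * n ^ m
        ≤⟨ *-monoˡ-≤ (n ^ m) (*-monoˡ-≤ (A ^ d) (count-mono (All.universal large⇒meets (dSubsets n d)))) ⟩
      meeting S m d * A ^ d * n ^ m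
        ≤⟨ weighted (m ≤? d) ⟩
      (n C d) * n ^ m
        ∎)
    where
    open ≤-Reasoning
    m s 2A : ℕ
    m = suc (d / Q)
    s = ∣ S ∣
    2A = 2 * A
    large⇒meets : ∀ W → T (d <ᵇ Q * ∣ W ∩ S ∣) → T (m ≤ᵇ ∣ W ∩ S ∣)
    large⇒meets W d<Qx = ≤⇒≤ᵇ (≰⇒> λ x≤d/Q → <⇒≱ (<ᵇ⇒< d _ d<Qx) (begin
      Q * ∣ W ∩ S ∣  ≤⟨ *-monoʳ-≤ Q x≤d/Q ⟩
      Q * (d / Q)    ≡⟨ *-comm Q (d / Q) ⟩
      d / Q * Q      ≤⟨ m/n*n≤m d Q ⟩
      d              ∎))
    d≤Qm : d ≤ Q * m
    d≤Qm = begin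
      d                  ≡⟨ m≡m%n+[m/n]*n d Q ⟩
      d % Q + d / Q * Q  ≤⟨ +-monoˡ-≤ (d / Q * Q) (<⇒≤ (m%n<n d Q)) ⟩
      Q + d / Q * Q      ≡⟨ trans (cong (Q +_) (*-comm (d / Q) Q)) (sym (*-suc Q (d / Q))) ⟩
      Q * m              ∎
    growth : 2 ^ d * A ^ d ≤ (2A ^ Q) ^ m
    growth = begin
      2 ^ d * A ^ d      ≡⟨ *-distribʳ-^ 2 A d ⟨
      2A ^ d             ≤⟨ ^-monoʳ-≤ 2A {{m*n≢0 2 A}} d≤Qm ⟩
      2A ^ (Q * m)       ≡⟨ ^-*-assoc 2A Q m ⟨
      (2A ^ Q) ^ m       ∎
    weighted : Dec (m ≤ d) → meeting S m d * A ^ d * n ^ m ≤ (n C d) * n ^ m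
    weighted (no m≰d) rewrite meeting-vanishes S (≰⇒> m≰d) = z≤n
    weighted (yes m≤d) = begin
      meeting S m d * A ^ d * n ^ m         ≡⟨ swap (meeting S m d) (A ^ d) (n ^ m) ⟩
      meeting S m d * n ^ m * A ^ d         ≤⟨ *-monoˡ-≤ (A ^ d) (meeting-ratio S m≤d) ⟩
      (n C d) * 2 ^ d * s ^ m * A ^ d       ≡⟨ shuffle (n C d) (2 ^ d) (s ^ m) (A ^ d) ⟩
      (n C d) * (2 ^ d * A ^ d) * s ^ m     ≤⟨ *-monoˡ-≤ (s ^ m) (*-monoʳ-≤ (n C d) growth) ⟩
      (n C d) * (2A ^ Q) ^ m * s ^ m        ≡⟨ trans (*-assoc (n C d) _ _) (cong ((n C d) *_) (sym (*-distribʳ-^ (2A ^ Q) s m))) ⟩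
      (n C d) * (2A ^ Q * s) ^ m            ≤⟨ *-monoʳ-≤ (n C d) (^-monoˡ-≤ m (≤-trans (≤-reflexive (*-comm (2A ^ Q) s)) sparse)) ⟩
      (n C d) * n ^ m                       ∎
      where
      swap : ∀ a b c → a * b * c ≡ a * c * b
      swap = solve-∀
      shuffle : ∀ a b c x → a * b * c * x ≡ a * (b * x) * c
      shuffle = solve-∀

  -- Slicing along the first coordinate

  module _ {k : ℕ} {n : Fin (suc k) → ℕ} where

    private
      n′ : Fin k → ℕ
      n′ i = n (suc i)

    slice : Family (suc k) n → Fin (n zero) → Family k n′
    slice H v y = H (consΠ v y)

    card-slices : ∀ H → card (suc k) n H ≡ ∑[ v ∈ allFinList (n zero) ] card k n′ (slice H v)
    card-slices H = trans (count-concatMap H _ (allFinList (n zero)))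
      (∑-cong (allFinList (n zero)) (λ v → count-map H (consΠ v) (allPoints k n′)))

    cardIn-slices : ∀ H W → cardIn (suc k) n H W ≡
      ∑[ v ∈ allFinList (n zero) ] 𝟙 ⌊ v ∈? W zero ⌋ * cardIn k n′ (slice H v) (λ i → W (suc i))
    cardIn-slices H W = trans (count-concatMap ∈ℋ∩W _ (allFinList (n zero)))
      (∑-cong (allFinList (n zero)) (λ v → trans (count-map ∈ℋ∩W (consΠ v) (allPoints k n′))
        (count-∧-guard (slice H v) (λ y → allFinᵇ k (λ i → ⌊ y i ∈? W (suc i) ⌋)) ⌊ v ∈? W zero ⌋ (allPoints k n′))))
      where
      ∈ℋ∩W : Point (suc k) n → Bool
      ∈ℋ∩W x = H x ∧ allFinᵇ (suc k) (λ i → ⌊ x i ∈? W i ⌋)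

    count-dChoices : ∀ d (p : Choice (suc k) n → Bool) → count p (dChoices (suc k) n d) ≡
      ∑[ W₁ ∈ dSubsets (n zero) d ] count (λ W → p (consΠ W₁ W)) (dChoices k n′ d)
    count-dChoices d p = trans (count-concatMap p _ (dSubsets (n zero) d))
      (∑-cong (dSubsets (n zero) d) (λ W₁ → count-map p (consΠ W₁) (dChoices k n′ d)))

    length-dChoices : ∀ d → length (dChoices (suc k) n d) ≡ (n zero C d) * length (dChoices k n′ d)
    length-dChoices d = begin
      length (dChoices (suc k) n d)                                  ≡⟨ count-true (dChoices (suc k) n d) ⟨
      count (λ _ → true) (dChoices (suc k) n d)                      ≡⟨ count-dChoices d (λ _ → true) ⟩
      ∑[ _ ∈ dSubsets (n zero) d ] count (λ _ → true) (dChoices k n′ d)  ≡⟨ ∑-const _ (dSubsets (n zero) d) ⟩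
      length (dSubsets (n zero) d) * count (λ _ → true) (dChoices k n′ d)
        ≡⟨ cong₂ _*_ (length-dSubsets (n zero) d) (count-true (dChoices k n′ d)) ⟩
      (n zero C d) * length (dChoices k n′ d)                        ∎
      where open ≡-Reasoning

  dChoices-size : ∀ k (n : Fin k → ℕ) d → All (λ W → ∀ i → ∣ W i ∣ ≡ d) (dChoices k n d)
  dChoices-size zero n d = (λ ()) ∷ []
  dChoices-size (suc k) n d = concat⁺ (map⁺ (All.map
    (λ {W₁} ∣W₁∣ → map⁺ (All.map (λ {W} ∣W∣ → λ { zero → ∣W₁∣ ; (suc i) → ∣W∣ i }) (dChoices-size k (λ i → n (suc i)) d)))
    (dSubsets-size (n zero) d)))

  cardIn≤card : ∀ k (n : Fin k → ℕ) H W → cardIn k n H W ≤ card k n H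
  cardIn≤card k n H W = count-mono (All.universal (λ x → proj₁ ∘ Equivalence.to T-∧) (allPoints k n))

  cardIn≤ : ∀ k (n : Fin k → ℕ) d H (W : Choice k n) → (∀ i → ∣ W i ∣ ≡ d) → cardIn k n H W ≤ d ^ k
  cardIn≤ zero n d H W _ = count≤length (λ x → H x ∧ true) (allPoints zero n)
  cardIn≤ (suc k) n d H W ∣W∣≡d = begin
    cardIn (suc k) n H W
      ≡⟨ cardIn-slices H W ⟩
    ∑[ v ∈ vs ] 𝟙 ⌊ v ∈? W zero ⌋ * cardIn k n′ (slice H v) (λ i → W (suc i))
      ≤⟨ ∑-mono-∀ vs (λ v → *-monoʳ-≤ (𝟙 ⌊ v ∈? W zero ⌋) (cardIn≤ k n′ d (slice H v) (λ i → W (suc i)) (λ i → ∣W∣≡d (suc i)))) ⟩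
    ∑[ v ∈ vs ] 𝟙 ⌊ v ∈? W zero ⌋ * d ^ k
      ≡⟨ ∑-*ʳ _ (d ^ k) vs ⟩
    (∑[ v ∈ vs ] 𝟙 ⌊ v ∈? W zero ⌋) * d ^ k
      ≡⟨ cong (_* d ^ k) (trans (sym (count≡∑ _ vs)) (trans (count-∈ (W zero)) (∣W∣≡d zero))) ⟩
    d ^ suc k
      ∎
    where
    open ≤-Reasoning
    n′ : Fin k → ℕ
    n′ i = n (suc i)
    vs : List (Fin (n zero))
    vs = allFinList (n zero)

  prodFin-nonZero : ∀ k (n : Fin k → ℕ) → (∀ i → NonZero (n i)) → NonZero (prodFin k n)
  prodFin-nonZero zero n _ = _
  prodFin-nonZero (suc k) n nz = m*n≢0 (n zero) _ {{nz zero}} {{prodFin-nonZero k (λ i → n (suc i)) (λ i → nz (suc i))}}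

  -- Heavy and light vertices

  vertex-bound : ∀ P D m h Y → Y ≤ D →
    P * (𝟙 m * Y) ≤ P * D * (𝟙 (m ∧ h) + 𝟙 (m ∧ not h) * 𝟙 (D <ᵇ P * Y)) + D * 𝟙 m
  vertex-bound P D false h Y _ = ≤-trans (≤-reflexive (*-zeroʳ P)) z≤n
  vertex-bound P D true h Y Y≤D = ≤-trans (≤-reflexive (cong (P *_) (*-identityˡ Y))) (bound h (D <ᵇ P * Y) refl)
    where
    open ≤-Reasoning
    P*Y≤P*D : P * Y ≤ P * D * 1
    P*Y≤P*D = ≤-trans (*-monoʳ-≤ P Y≤D) (≤-reflexive (sym (*-identityʳ (P * D))))
    bound : ∀ h b → (D <ᵇ P * Y) ≡ b → P * Y ≤ P * D * (𝟙 h + 𝟙 (not h) * 𝟙 b) + D * 1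
    bound true b _ = ≤-trans P*Y≤P*D (m≤m+n _ _)
    bound false true _ = ≤-trans P*Y≤P*D (m≤m+n _ _)
    bound false false good = begin
      P * Y                                  ≤⟨ ≮⇒≥ (λ D<PY → subst T good (<⇒<ᵇ D<PY)) ⟩
      D                                      ≡⟨ *-identityʳ D ⟨
      D * 1                                  ≤⟨ m≤n+m (D * 1) _ ⟩
      P * D * (0 + 0) + D * 1                ∎

  module _ {V : Set} (vs : List V) (inW heavy : V → Bool) (Y : V → ℕ) (D Q : ℕ) where

    private
      P h X : ℕ
      P = 2 * Q
      h = count (λ v → inW v ∧ heavy v) vs
      X = ∑[ v ∈ vs ] 𝟙 (inW v) * Y v

    lightExcess : ℕ
    lightExcess = ∑[ v ∈ vs ] 𝟙 (inW v ∧ not (heavy v)) * 𝟙 (D <ᵇ P * Y v)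

    weighted-bound : (∀ v → Y v ≤ D) → P * X ≤ P * D * (h + lightExcess) + D * count inW vs
    weighted-bound Y≤D = begin
      P * X
        ≡⟨ ∑-*ˡ P _ vs ⟨
      ∑[ v ∈ vs ] P * (𝟙 (inW v) * Y v)
        ≤⟨ ∑-mono-∀ vs (λ v → vertex-bound P D (inW v) (heavy v) (Y v) (Y≤D v)) ⟩
      ∑[ v ∈ vs ] (P * D * (𝟙 (inW v ∧ heavy v) + light v) + D * 𝟙 (inW v))
        ≡⟨ ∑-+ vs ⟩
      (∑[ v ∈ vs ] P * D * (𝟙 (inW v ∧ heavy v) + light v)) + (∑[ v ∈ vs ] D * 𝟙 (inW v))
        ≡⟨ cong₂ _+_ (trans (∑-*ˡ (P * D) _ vs) (cong (P * D *_) (trans (∑-+ vs) (cong (_+ lightExcess) (sym (count≡∑ _ vs))))))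
                     (trans (∑-*ˡ D _ vs) (cong (D *_) (sym (count≡∑ inW vs)))) ⟩
      P * D * (h + lightExcess) + D * count inW vs
        ∎
      where
      open ≤-Reasoning
      light : V → ℕ
      light v = 𝟙 (inW v ∧ not (heavy v)) * 𝟙 (D <ᵇ P * Y v)

    -- A heavy or bad light vertex of W adds at most D to X and a good light one at most D/2Q, so with
    -- no bad light vertex, Q · X > d · D forces more than d/2Q heavy vertices in W.
    heavy-or-light : ∀ {d} → (∀ v → Y v ≤ D) → count inW vs ≡ d → 𝟙 (d * D <ᵇ Q * X) ≤ 𝟙 (d <ᵇ P * h) + lightExcess
    heavy-or-light {d} Y≤D ∣W∣≡d =
      𝟙-split _ _ lightExcess (λ dD<QX noLight → <⇒<ᵇ (many-heavy (<ᵇ⇒< _ _ dD<QX) noLight))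
      where
      open ≤-Reasoning
      many-heavy : d * D < Q * X → lightExcess ≡ 0 → d < P * h
      many-heavy dD<QX noLight = *-cancelʳ-< D d (P * h) (+-cancelʳ-≤ (d * D) (suc (d * D)) (P * h * D) (begin
        suc (d * D) + d * D                           ≤⟨ +-monoʳ-≤ (suc (d * D)) (n≤1+n (d * D)) ⟩
        suc (d * D) + suc (d * D)                     ≡⟨ double (suc (d * D)) ⟩
        2 * suc (d * D)                               ≤⟨ *-monoʳ-≤ 2 dD<QX ⟩
        2 * (Q * X)                                   ≡⟨ *-assoc 2 Q X ⟨
        P * X                                         ≤⟨ weighted-bound Y≤D ⟩
        P * D * (h + lightExcess) + D * count inW vs  ≡⟨ cong₂ (λ t c → P * D * (h + t) + D * c) noLight ∣W∣≡d ⟩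
        P * D * (h + 0) + D * d                       ≡⟨ regroup P D h d ⟩
        P * h * D + d * D                             ∎))
        where
        double : ∀ a → a + a ≡ 2 * a
        double = solve-∀
        regroup : ∀ P D h d → P * D * (h + 0) + D * d ≡ P * h * D + d * D
        regroup = solve-∀

  -- Induction on the number of coordinates

  deviations : ∀ k (n : Fin k → ℕ) d → Family k n → ℕ → ℕ
  deviations k n d H Q = count (λ W → d ^ k <ᵇ Q * cardIn k n H W) (dChoices k n d)

  DeviationBound : ℕ → ℕ → ℕ → ℕ → Set
  DeviationBound k Q A N = (n : Fin k → ℕ) (d : ℕ) → 1 ≤ d → (∀ i → d ≤ n i) → (H : Family k n) →
    card k n H * N ≤ prodFin k n → deviations k n d H Q * A ^ d ≤ length (dChoices k n d)

  Concentrated : ℕ → Set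
  Concentrated k = ∀ Q A .{{_ : NonZero Q}} .{{_ : NonZero A}} → ∃[ N ] (NonZero N × DeviationBound k Q A N)

  concentration-zero : Concentrated zero
  concentration-zero Q A = 2 , _ , λ n d _ _ H sparse →
    ≤-trans (≤-reflexive (cong (_* A ^ d) (no-deviations n d H (empty H sparse)))) z≤n
    where
    empty : ∀ {n} (H : Family zero n) → card zero n H * 2 ≤ 1 → card zero n H ≡ 0
    empty H sparse with card _ _ H
    ... | zero = refl
    ... | suc c = contradiction sparse λ { (s≤s ()) }
    no-deviations : ∀ n d H → card zero n H ≡ 0 → deviations zero n d H Q ≡ 0
    no-deviations n d H card≡0 = n≤0⇒n≡0 (begin
      deviations zero n d H Q                  ≤⟨ count-mono (All.universal impossible (dChoices zero n d)) ⟩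
      count (λ _ → false) (dChoices zero n d)  ≡⟨ count-false (dChoices zero n d) ⟩
      0                                        ∎)
      where
      open ≤-Reasoning
      impossible : ∀ W → T (1 <ᵇ Q * cardIn zero n H W) → T false
      impossible W 1<Qc = <⇒≱ (<ᵇ⇒< 1 _ 1<Qc) (begin
        Q * cardIn zero n H W  ≤⟨ *-monoʳ-≤ Q (≤-trans (cardIn≤card zero n H W) (≤-reflexive card≡0)) ⟩
        Q * 0                  ≡⟨ *-zeroʳ Q ⟩
        0                      ≤⟨ z≤n ⟩
        1                      ∎)

  combine-bounds : ∀ {T B Lt L L′} A d → 1 ≤ d → T ≤ L′ * B + Lt →
    B * (2 * A) ^ d ≤ L → Lt * (4 * A) ^ d ≤ L * (d * L′) → T * A ^ d ≤ L * L′
  combine-bounds {T} {B} {Lt} {L} {L′} A d 1≤d T≤ B-bound Lt-bound = *-cancelˡ-≤ 2 (begin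
    2 * (T * A ^ d)                            ≤⟨ *-monoʳ-≤ 2 (*-monoˡ-≤ (A ^ d) T≤) ⟩
    2 * ((L′ * B + Lt) * A ^ d)                ≡⟨ expand L′ B Lt (A ^ d) ⟩
    L′ * (2 * (B * A ^ d)) + 2 * (Lt * A ^ d)  ≤⟨ +-mono-≤ (*-monoʳ-≤ L′ B-half) Lt-half ⟩
    L′ * L + L * L′                            ≡⟨ double L L′ ⟩
    2 * (L * L′)                               ∎)
    where
    open ≤-Reasoning
    expand : ∀ a b c x → 2 * ((a * b + c) * x) ≡ a * (2 * (b * x)) + 2 * (c * x)
    expand = solve-∀
    double : ∀ a b → b * a + a * b ≡ 2 * (a * b)
    double = solve-∀
    pull : ∀ c x y → c * (x * y) ≡ x * (c * y)
    pull = solve-∀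
    B-half : 2 * (B * A ^ d) ≤ L
    B-half = begin
      2 * (B * A ^ d)      ≤⟨ *-monoˡ-≤ (B * A ^ d) (2≤2^ d 1≤d) ⟩
      2 ^ d * (B * A ^ d)  ≡⟨ trans (pull (2 ^ d) B (A ^ d)) (cong (B *_) (sym (*-distribʳ-^ 2 A d))) ⟩
      B * (2 * A) ^ d      ≤⟨ B-bound ⟩
      L                    ∎
    Lt-half : 2 * (Lt * A ^ d) ≤ L * L′
    Lt-half = *-cancelˡ-≤ d {{>-nonZero 1≤d}} (begin
      d * (2 * (Lt * A ^ d))    ≡⟨ trans (sym (*-assoc d 2 _)) (cong (_* (Lt * A ^ d)) (*-comm d 2)) ⟩
      2 * d * (Lt * A ^ d)      ≤⟨ *-monoˡ-≤ (Lt * A ^ d) (2*n≤4^n d) ⟩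
      4 ^ d * (Lt * A ^ d)      ≡⟨ trans (pull (4 ^ d) Lt (A ^ d)) (cong (Lt *_) (sym (*-distribʳ-^ 4 A d))) ⟩
      Lt * (4 * A) ^ d          ≤⟨ Lt-bound ⟩
      L * (d * L′)              ≡⟨ pull L d L′ ⟩
      d * (L * L′)              ∎)

  module Step {k : ℕ} (IH : Concentrated k) (Q A : ℕ) .{{_ : NonZero Q}} .{{_ : NonZero A}} where

    private instance
      2Q≢0 : NonZero (2 * Q)
      2Q≢0 = m*n≢0 2 Q
      2A≢0 : NonZero (2 * A)
      2A≢0 = m*n≢0 2 A
      4A≢0 : NonZero (4 * A)
      4A≢0 = m*n≢0 4 A

    -- N′ keeps the slices of light vertices within reach of the induction hypothesis (run with 2Q and 4A);
    -- N₁ makes the heavy vertices sparse enough for few-heavy-meetings (run with 2Q and 2A).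
    Q′ N′ N₁ N : ℕ
    Q′ = 2 * Q
    N′ = proj₁ (IH Q′ (4 * A))
    N₁ = (2 * (2 * A)) ^ Q′
    N = N′ * N₁

    N-nonZero : NonZero N
    N-nonZero = m*n≢0 N′ N₁ {{proj₁ (proj₂ (IH Q′ (4 * A)))}} {{m^n≢0 (2 * (2 * A)) Q′ {{m*n≢0 2 (2 * A)}}}}

    module _ (n : Fin (suc k) → ℕ) (d : ℕ) (1≤d : 1 ≤ d) (d≤n : ∀ i → d ≤ n i) (H : Family (suc k) n)
             (sparse : card (suc k) n H * N ≤ prodFin (suc k) n) where

      private
        n′ : Fin k → ℕ
        n′ i = n (suc i)
        n₀ P′ L′ : ℕ
        n₀ = n zero
        P′ = prodFin k n′
        L′ = length (dChoices k n′ d)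
        vs : List (Fin n₀)
        vs = allFinList n₀
        open ≤-Reasoning

      heavy : Fin n₀ → Bool
      heavy v = P′ <ᵇ N′ * card k n′ (slice H v)

      heavySet : Subset n₀
      heavySet = tabulate heavy

      heavySet-sparse : ∣ heavySet ∣ * N₁ ≤ n₀
      heavySet-sparse = *-cancelʳ-≤ _ _ P′ {{prodFin-nonZero k n′ (λ i → >-nonZero (≤-trans 1≤d (d≤n (suc i))))}} (begin
        ∣ heavySet ∣ * N₁ * P′
          ≡⟨ cong (λ c → c * N₁ * P′) (count-tabulate heavy) ⟨
        count heavy vs * N₁ * P′
          ≡⟨ rotate (count heavy vs) N₁ P′ ⟩
        P′ * count heavy vs * N₁
          ≡⟨ cong (_* N₁) (trans (cong (P′ *_) (count≡∑ heavy vs)) (sym (∑-*ˡ P′ _ vs))) ⟩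
        (∑[ v ∈ vs ] P′ * 𝟙 (heavy v)) * N₁
          ≤⟨ *-monoˡ-≤ N₁ (∑-mono-∀ vs heavy-mass) ⟩
        (∑[ v ∈ vs ] N′ * card k n′ (slice H v)) * N₁
          ≡⟨ cong (_* N₁) (trans (∑-*ˡ N′ _ vs) (cong (N′ *_) (sym (card-slices H)))) ⟩
        N′ * card (suc k) n H * N₁
          ≡⟨ rotate′ N′ (card (suc k) n H) N₁ ⟩
        card (suc k) n H * N
          ≤⟨ sparse ⟩
        n₀ * P′
          ∎)
        where
        rotate : ∀ a b c → a * b * c ≡ c * a * b
        rotate = solve-∀
        rotate′ : ∀ a b c → a * b * c ≡ b * (a * c)
        rotate′ = solve-∀
        heavy-mass : ∀ v → P′ * 𝟙 (heavy v) ≤ N′ * card k n′ (slice H v)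
        heavy-mass v with heavy v in eq
        ... | true = ≤-trans (≤-reflexive (*-identityʳ P′)) (<⇒≤ (<ᵇ⇒< P′ _ (subst T (sym eq) _)))
        ... | false = ≤-trans (≤-reflexive (*-zeroʳ P′)) z≤n

      light-slice-sparse : ∀ v → heavy v ≡ false → card k n′ (slice H v) * N′ ≤ P′
      light-slice-sparse v light = ≤-trans (≤-reflexive (*-comm _ N′)) (≮⇒≥ (λ P′< → subst T light (<⇒<ᵇ P′<)))

      badFirst : Subset n₀ → Bool
      badFirst W₁ = d <ᵇ Q′ * ∣ W₁ ∩ heavySet ∣

      lightDeviations : Subset n₀ → ℕ
      lightDeviations W₁ = ∑[ v ∈ vs ] 𝟙 (⌊ v ∈? W₁ ⌋ ∧ not (heavy v)) * deviations k n′ d (slice H v) Q′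

      deviates : Choice (suc k) n → Bool
      deviates W = d ^ suc k <ᵇ Q * cardIn (suc k) n H W

      deviations-fibre : ∀ W₁ → ∣ W₁ ∣ ≡ d →
        count (λ W → deviates (consΠ W₁ W)) (dChoices k n′ d) ≤ L′ * 𝟙 (badFirst W₁) + lightDeviations W₁
      deviations-fibre W₁ ∣W₁∣≡d = begin
        count (λ W → deviates (consΠ W₁ W)) (dChoices k n′ d)
          ≡⟨ count≡∑ _ (dChoices k n′ d) ⟩
        ∑[ W ∈ dChoices k n′ d ] 𝟙 (deviates (consΠ W₁ W))
          ≤⟨ ∑-mono (All.map (λ {W} → pointwise W) (dChoices-size k n′ d)) ⟩
        ∑[ W ∈ dChoices k n′ d ] (𝟙 (badFirst W₁) + excess W)
          ≡⟨ ∑-+ (dChoices k n′ d) ⟩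
        (∑[ W ∈ dChoices k n′ d ] 𝟙 (badFirst W₁)) + (∑[ W ∈ dChoices k n′ d ] excess W)
          ≡⟨ cong₂ _+_ (∑-const (𝟙 (badFirst W₁)) (dChoices k n′ d)) (∑-comm _ (dChoices k n′ d) vs) ⟩
        L′ * 𝟙 (badFirst W₁) + (∑[ v ∈ vs ] ∑[ W ∈ dChoices k n′ d ] 𝟙 (inW v ∧ not (heavy v)) * 𝟙 (bad v W))
          ≡⟨ cong (L′ * 𝟙 (badFirst W₁) +_) (∑-cong vs (λ v →
               trans (∑-*ˡ (𝟙 (inW v ∧ not (heavy v))) _ (dChoices k n′ d))
                     (cong (𝟙 (inW v ∧ not (heavy v)) *_) (sym (count≡∑ (bad v) (dChoices k n′ d)))))) ⟩
        L′ * 𝟙 (badFirst W₁) + lightDeviations W₁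
          ∎
        where
        inW : Fin n₀ → Bool
        inW v = ⌊ v ∈? W₁ ⌋
        Y : Choice k n′ → Fin n₀ → ℕ
        Y W v = cardIn k n′ (slice H v) W
        bad : Fin n₀ → Choice k n′ → Bool
        bad v W = d ^ k <ᵇ Q′ * Y W v
        excess : Choice k n′ → ℕ
        excess W = lightExcess vs inW heavy (Y W) (d ^ k) Q
        pointwise : ∀ W → (∀ i → ∣ W i ∣ ≡ d) → 𝟙 (deviates (consΠ W₁ W)) ≤ 𝟙 (badFirst W₁) + excess W
        pointwise W ∣W∣≡d =
          subst₂ (λ x h → 𝟙 (d ^ suc k <ᵇ Q * x) ≤ 𝟙 (d <ᵇ Q′ * h) + excess W)
            (sym (cardIn-slices H (consΠ W₁ W))) (count-∈-∩ W₁ heavy)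
            (heavy-or-light vs inW heavy (Y W) (d ^ k) Q (λ v → cardIn≤ k n′ d (slice H v) W ∣W∣≡d)
                            (trans (count-∈ W₁) ∣W₁∣≡d))

      deviations-split : deviations (suc k) n d H Q ≤
        L′ * count badFirst (dSubsets n₀ d) + (∑[ W₁ ∈ dSubsets n₀ d ] lightDeviations W₁)
      deviations-split = begin
        deviations (suc k) n d H Q
          ≡⟨ count-dChoices d deviates ⟩
        ∑[ W₁ ∈ dSubsets n₀ d ] count (λ W → deviates (consΠ W₁ W)) (dChoices k n′ d)
          ≤⟨ ∑-mono (All.map (λ {W₁} → deviations-fibre W₁) (dSubsets-size n₀ d)) ⟩
        ∑[ W₁ ∈ dSubsets n₀ d ] (L′ * 𝟙 (badFirst W₁) + lightDeviations W₁)
          ≡⟨ ∑-+ (dSubsets n₀ d) ⟩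
        (∑[ W₁ ∈ dSubsets n₀ d ] L′ * 𝟙 (badFirst W₁)) + (∑[ W₁ ∈ dSubsets n₀ d ] lightDeviations W₁)
          ≡⟨ cong (_+ (∑[ W₁ ∈ dSubsets n₀ d ] lightDeviations W₁))
                  (trans (∑-*ˡ L′ _ (dSubsets n₀ d)) (cong (L′ *_) (sym (count≡∑ badFirst (dSubsets n₀ d))))) ⟩
        L′ * count badFirst (dSubsets n₀ d) + (∑[ W₁ ∈ dSubsets n₀ d ] lightDeviations W₁)
          ∎

      lightDeviations-bound : ∀ W₁ → ∣ W₁ ∣ ≡ d → lightDeviations W₁ * (4 * A) ^ d ≤ d * L′
      lightDeviations-bound W₁ ∣W₁∣≡d = begin
        lightDeviations W₁ * (4 * A) ^ d
          ≡⟨ ∑-*ʳ _ ((4 * A) ^ d) vs ⟨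
        ∑[ v ∈ vs ] 𝟙 (⌊ v ∈? W₁ ⌋ ∧ not (heavy v)) * deviations k n′ d (slice H v) Q′ * (4 * A) ^ d
          ≤⟨ ∑-mono-∀ vs (λ v → light-vertex v ⌊ v ∈? W₁ ⌋ (heavy v) refl) ⟩
        ∑[ v ∈ vs ] 𝟙 ⌊ v ∈? W₁ ⌋ * L′
          ≡⟨ ∑-*ʳ _ L′ vs ⟩
        (∑[ v ∈ vs ] 𝟙 ⌊ v ∈? W₁ ⌋) * L′
          ≡⟨ cong (_* L′) (trans (sym (count≡∑ _ vs)) (trans (count-∈ W₁) ∣W₁∣≡d)) ⟩
        d * L′
          ∎
        where
        light-vertex : ∀ v m h → heavy v ≡ h →
          𝟙 (m ∧ not h) * deviations k n′ d (slice H v) Q′ * (4 * A) ^ d ≤ 𝟙 m * L′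
        light-vertex v false _ _ = z≤n
        light-vertex v true true _ = z≤n
        light-vertex v true false light = begin
          1 * deviations k n′ d (slice H v) Q′ * (4 * A) ^ d
            ≡⟨ cong (_* (4 * A) ^ d) (*-identityˡ (deviations k n′ d (slice H v) Q′)) ⟩
          deviations k n′ d (slice H v) Q′ * (4 * A) ^ d
            ≤⟨ proj₂ (proj₂ (IH Q′ (4 * A))) n′ d 1≤d (d≤n ∘ suc) (slice H v) (light-slice-sparse v light) ⟩
          L′
            ≡⟨ *-identityˡ L′ ⟨
          1 * L′
            ∎

      lightDeviations-total : (∑[ W₁ ∈ dSubsets n₀ d ] lightDeviations W₁) * (4 * A) ^ d ≤ (n₀ C d) * (d * L′)
      lightDeviations-total = begin
        (∑[ W₁ ∈ dSubsets n₀ d ] lightDeviations W₁) * (4 * A) ^ d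
          ≡⟨ ∑-*ʳ lightDeviations _ (dSubsets n₀ d) ⟨
        ∑[ W₁ ∈ dSubsets n₀ d ] lightDeviations W₁ * (4 * A) ^ d
          ≤⟨ ∑-mono (All.map (λ {W₁} → lightDeviations-bound W₁) (dSubsets-size n₀ d)) ⟩
        ∑[ _ ∈ dSubsets n₀ d ] d * L′
          ≡⟨ trans (∑-const (d * L′) (dSubsets n₀ d)) (cong (_* (d * L′)) (length-dSubsets n₀ d)) ⟩
        (n₀ C d) * (d * L′)
          ∎

      concentrated : deviations (suc k) n d H Q * A ^ d ≤ length (dChoices (suc k) n d)
      concentrated = subst (deviations (suc k) n d H Q * A ^ d ≤_) (sym (length-dChoices {k} {n} d))
        (combine-bounds A d 1≤d deviations-split
          (few-heavy-meetings Q′ (2 * A) heavySet 1≤d (d≤n zero) heavySet-sparse)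
          lightDeviations-total)

  concentration-suc : ∀ {k} → Concentrated k → Concentrated (suc k)
  concentration-suc IH Q A = Step.N IH Q A , Step.N-nonZero IH Q A , Step.concentrated IH Q A

  concentration : ∀ k → Concentrated k
  concentration zero = concentration-zero
  concentration (suc k) = concentration-suc (concentration k)

-- Translation to rational numbers

open Concentration using (DeviationBound; concentration; deviations; count-mono)
open import Data.Nat using (ℕ; _≤_)
open import Data.List using (length)
open import Data.Fin using (Fin)
open import Data.Product using (Σ; _×_)
open import Data.Rational using (ℚ; 0ℚ; _*_; _<_) renaming (_≤_ to _≤ℚ_)

open import Data.Bool using (T)
open import Data.Nat as ℕ using (zero; suc; z≤n; s≤s; _^_; NonZero)
import Data.Nat.Properties as ℕ
open import Data.Nat.Coprimality using (Coprime; 1-coprimeTo)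
import Data.Nat.Coprimality as Coprime
open import Data.Integer as ℤ using (+_; +[1+_]; -[1+_]; +≤+; +<+)
import Data.Integer.Properties as ℤ
open import Data.Rational using (mkℚ; toℚᵘ; *<*)
open import Data.Rational.Properties as ℚ using (_<?_; toℚᵘ-mono-≤; toℚᵘ-cancel-≤; toℚᵘ-mono-<; toℚᵘ-homo-*)
open import Data.Rational.Unnormalised as ℚᵘ using (ℚᵘ; mkℚᵘ; *≤*; *<*)
  renaming (_≤_ to _≤ᵘ_; _<_ to _<ᵘ_; _*_ to _*ᵘ_; _≃_ to _≃ᵘ_)
import Data.Rational.Unnormalised.Properties as ℚᵘ
open import Data.Product using (_,_; proj₁; proj₂)
import Data.List.Relation.Unary.All as All
open import Relation.Binary.PropositionalEquality using (_≡_; cong; cong₂; subst; subst₂; sym; trans)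
open import Relation.Nullary.Decidable using (⌊_⌋; toWitness)

-- frac a b is a / (1 + b), following the shifted denominator of mkℚᵘ.
frac : ℕ → ℕ → ℚᵘ
frac a b = mkℚᵘ (+ a) b

frac-≤⁻ : ∀ {a b c e} → frac a b ≤ᵘ frac c e → a ℕ.* suc e ≤ c ℕ.* suc b
frac-≤⁻ {a} {b} {c} {e} (*≤* le) = ℤ.drop‿+≤+ (subst₂ ℤ._≤_ (sym (ℤ.pos-* a (suc e))) (sym (ℤ.pos-* c (suc b))) le)

frac-≤⁺ : ∀ {a b c e} → a ℕ.* suc e ≤ c ℕ.* suc b → frac a b ≤ᵘ frac c e
frac-≤⁺ {a} {b} {c} {e} le = *≤* (subst₂ ℤ._≤_ (ℤ.pos-* a (suc e)) (ℤ.pos-* c (suc b)) (+≤+ le))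

frac-<⁻ : ∀ {a b c e} → frac a b <ᵘ frac c e → a ℕ.* suc e ℕ.< c ℕ.* suc b
frac-<⁻ {a} {b} {c} {e} (*<* lt) = ℤ.drop‿+<+ (subst₂ ℤ._<_ (sym (ℤ.pos-* a (suc e))) (sym (ℤ.pos-* c (suc b))) lt)

toℚᵘ-toℚ : ∀ n → toℚᵘ (toℚ n) ≡ frac n 0
toℚᵘ-toℚ n = cong toℚᵘ (ℚ.↥p/↧p≡p (mkℚ (+ n) 0 (Coprime.sym (1-coprimeTo n))))

toℚ-mono-≤ : ∀ {m n} → m ≤ n → toℚ m ≤ℚ toℚ n
toℚ-mono-≤ {m} {n} m≤n =
  toℚᵘ-cancel-≤ (subst₂ _≤ᵘ_ (sym (toℚᵘ-toℚ m)) (sym (toℚᵘ-toℚ n)) (frac-≤⁺ (ℕ.*-monoˡ-≤ 1 m≤n)))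

module _ {a b : ℕ} .{c : Coprime a (suc b)} where

  private
    p : ℚ
    p = mkℚ (+ a) b c

  toℚᵘ-*-toℚ : ∀ n → toℚᵘ (p * toℚ n) ≃ᵘ frac (a ℕ.* n) b
  toℚᵘ-*-toℚ n = subst (toℚᵘ (p * toℚ n) ≃ᵘ_)
    (trans (cong (frac a b *ᵘ_) (toℚᵘ-toℚ n)) (cong₂ mkℚᵘ (sym (ℤ.pos-* a n)) (ℕ.*-identityʳ b)))
    (toℚᵘ-homo-* p (toℚ n))

  ≤-*toℚ⁻ : ∀ {m n} → toℚ m ≤ℚ p * toℚ n → m ℕ.* suc b ≤ a ℕ.* n
  ≤-*toℚ⁻ {m} {n} le = ℕ.≤-trans
    (frac-≤⁻ (ℚᵘ.≤-respʳ-≃ (toℚᵘ-*-toℚ n) (subst (_≤ᵘ toℚᵘ (p * toℚ n)) (toℚᵘ-toℚ m) (toℚᵘ-mono-≤ le))))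
    (ℕ.≤-reflexive (ℕ.*-identityʳ _))

  ≤-*toℚ⁺ : ∀ {m n} → m ℕ.* suc b ≤ a ℕ.* n → toℚ m ≤ℚ p * toℚ n
  ≤-*toℚ⁺ {m} {n} le = toℚᵘ-cancel-≤ (ℚᵘ.≤-respʳ-≃ (ℚᵘ.≃-sym (toℚᵘ-*-toℚ n))
    (subst (_≤ᵘ frac (a ℕ.* n) b) (sym (toℚᵘ-toℚ m)) (frac-≤⁺ (ℕ.≤-trans le (ℕ.≤-reflexive (sym (ℕ.*-identityʳ _)))))))

  <-*toℚ⁻ : ∀ {m n} → p * toℚ n < toℚ m → a ℕ.* n ℕ.< m ℕ.* suc b
  <-*toℚ⁻ {m} {n} lt = ℕ.≤-trans (ℕ.≤-reflexive (cong suc (sym (ℕ.*-identityʳ _))))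
    (frac-<⁻ (ℚᵘ.<-respˡ-≃ (toℚᵘ-*-toℚ n) (subst (toℚᵘ (p * toℚ n) <ᵘ_) (toℚᵘ-toℚ m) (toℚᵘ-mono-< lt))))

^ℚ-*toℚ⁺ : ∀ {u a} .{c : Coprime (suc u) (suc a)} d {B L} →
  B ℕ.* suc a ^ d ≤ L → toℚ B ≤ℚ mkℚ +[1+ u ] a c ^ℚ d * toℚ L
^ℚ-*toℚ⁺ zero {B} {L} le =
  ℚ.≤-trans (toℚ-mono-≤ (ℕ.≤-trans (ℕ.≤-reflexive (sym (ℕ.*-identityʳ B))) le)) (ℚ.≤-reflexive (sym (ℚ.*-identityˡ (toℚ L))))
^ℚ-*toℚ⁺ {u} {a} {c} (suc d) {B} {L} le = begin
  toℚ B                  ≤⟨ ≤-*toℚ⁺ {m = B} {B ℕ.* suc a} (ℕ.m≤n*m (B ℕ.* suc a) (suc u)) ⟩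
  α * toℚ (B ℕ.* suc a)  ≤⟨ ℚ.*-monoˡ-≤-nonNeg α (^ℚ-*toℚ⁺ d {B ℕ.* suc a} {L} (ℕ.≤-trans (ℕ.≤-reflexive (ℕ.*-assoc B (suc a) _)) le)) ⟩
  α * (α ^ℚ d * toℚ L)   ≡⟨ ℚ.*-assoc α (α ^ℚ d) (toℚ L) ⟨
  α ^ℚ suc d * toℚ L     ∎
  where
  open ℚ.≤-Reasoning
  α : ℚ
  α = mkℚ +[1+ u ] a c

-- With α = (u + 1)/(a + 1) and lam = (l + 1)/(q + 1), run the concentration bound with Q = q + 1,
-- A = a + 1 and take τ = 1/N.
lemma3p6 : (k : ℕ) → 1 ≤ k → (α lam : ℚ) → 0ℚ < α → 0ℚ < lam →
    Σ ℚ (λ τ → 0ℚ < τ ×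
      ((n : Fin k → ℕ) (d : ℕ) → 2 ≤ d → ((i : Fin k) → d ≤ n i) →
       (H : Family k n) →
       toℚ (card k n H) ≤ℚ τ * toℚ (prodFin k n) →
       toℚ (badCount k n d H lam) ≤ℚ (α ^ℚ d) * toℚ (length (dChoices k n d))))
lemma3p6 k _ (mkℚ (+ 0) _ _) _ (*<* (+<+ ())) _
lemma3p6 k _ (mkℚ -[1+ _ ] _ _) _ (*<* ()) _
lemma3p6 k _ _ (mkℚ (+ 0) _ _) _ (*<* (+<+ ()))
lemma3p6 k _ _ (mkℚ -[1+ _ ] _ _) _ (*<* ())
lemma3p6 k _ (mkℚ +[1+ u ] a _) lam@(mkℚ +[1+ l ] q _) _ _ =
  mkℚ (+ 1) (ℕ.pred N) (1-coprimeTo _) , *<* (+<+ (s≤s z≤n)) , λ n d 2≤d d≤n H sparse →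
    ^ℚ-*toℚ⁺ d {badCount k n d H lam} {length (dChoices k n d)}
      (ℕ.≤-trans (ℕ.*-monoˡ-≤ (suc a ^ d) (badCount≤deviations n d H))
                 (concentrated n d (ℕ.≤-trans (s≤s z≤n) 2≤d) d≤n H (card-sparse n H sparse)))
  where
  N : ℕ
  N = proj₁ (concentration k (suc q) (suc a))
  instance
    N≢0 : NonZero N
    N≢0 = proj₁ (proj₂ (concentration k (suc q) (suc a)))
  concentrated : DeviationBound k (suc q) (suc a) N
  concentrated = proj₂ (proj₂ (concentration k (suc q) (suc a)))
  card-sparse : ∀ n H → toℚ (card k n H) ≤ℚ mkℚ (+ 1) (ℕ.pred N) (1-coprimeTo _) * toℚ (prodFin k n) →
                card k n H ℕ.* N ≤ prodFin k n
  card-sparse n H sparse = subst₂ _≤_ (cong (card k n H ℕ.*_) (ℕ.suc-pred N)) (ℕ.*-identityˡ _)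
    (≤-*toℚ⁻ {m = card k n H} {prodFin k n} sparse)
  badCount≤deviations : ∀ n d H → badCount k n d H lam ≤ deviations k n d H (suc q)
  badCount≤deviations n d H = count-mono (All.universal deviates (dChoices k n d))
    where
    deviates : ∀ W → T ⌊ lam * toℚ (d ^ k) <? toℚ (cardIn k n H W) ⌋ → T (d ^ k ℕ.<ᵇ suc q ℕ.* cardIn k n H W)
    deviates W lt = ℕ.<⇒<ᵇ (ℕ.≤-<-trans (ℕ.m≤n*m (d ^ k) (suc l))
      (ℕ.<-≤-trans (<-*toℚ⁻ {m = cardIn k n H W} {d ^ k} (toWitness lt)) (ℕ.≤-reflexive (ℕ.*-comm (cardIn k n H W) (suc q)))))
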